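{- Let $m,t \in \mathbb{N}$ and $\delta > 0$. There exists $n_0$ such that the following holds for all $n \geq n_0$. Let $H$ be an $n$-vertex triple system and let $F \subseteq \partial H$ be a graph such that every $f \in F$ satisfies $d_H(f) \geq m$. If $|F| \geq \delta n^2$, then $F$ contains a complete bipartite graph $K_{t,t}$ with out-codegree at least $m$.
   Context: A triple system $H$ is a family of $3$-element subsets of a finite vertex set $V(H)$; $\partial H$ is the graph of pairs contained in some edge of $H$, and $d_H(f)$ is the number of edges of $H$ containing the pair $f$. A graph $K \subseteq \partial H$ has out-codegree at least $d$ if for every edge $e \in K$ there exist distinct vertices $v_1,\dots,v_d \in V(H) \setminus V(K)$ with $e \cup \{v_i\} \in H$ for all $i \leq d$.
   Formalization: The parameter δ ranges over the positive rationals. -}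

module Defs where

open import Data.Nat using (ℕ; zero; suc; _*_; _≤_; _^_)
open import Data.Bool using (Bool; true; false; _∧_)
open import Data.Fin using (Fin)
open import Data.Fin.Subset using (Subset; _∈_; _∉_; _⊆_; ⁅_⁆; _∪_; ∣_∣; inside; outside)
open import Data.Fin.Subset.Properties using (_⊆?_)
open import Data.List using (List; []; _∷_; map; _++_; filter; length)
open import Data.Vec using (_∷_; [])
open import Data.Product using (Σ; ∃; _×_; _,_)
open import Function.Definitions using (Injective)
open import Relation.Binary.PropositionalEquality using (_≡_; _≢_)
open import Relation.Nullary using (does; ¬_)
open import Relation.Nullary.Decidable using (isYes)
open import Data.Bool.Properties using (T?)

allSubsets : (n : ℕ) → List (Subset n)
allSubsets zero = [] ∷ []
allSubsets (suc n) = map (outside ∷_) (allSubsets n) ++ map (inside ∷_) (allSubsets n)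

record TripleSystem (n : ℕ) : Set where
  field
    edge   : Subset n → Bool
    size-3 : ∀ e → edge e ≡ true → ∣ e ∣ ≡ 3
open TripleSystem public

record Graph (n : ℕ) : Set where
  field
    isEdge : Subset n → Bool
    size-2 : ∀ f → isEdge f ≡ true → ∣ f ∣ ≡ 2
open Graph public

numEdges : ∀ {n} → Graph n → ℕ
numEdges {n} F = length (filter (λ f → T? (isEdge F f)) (allSubsets n))

codeg : ∀ {n} → TripleSystem n → Subset n → ℕ
codeg {n} H f = length (filter (λ e → T? (edge H e ∧ does (f ⊆? e))) (allSubsets n))

InShadow : ∀ {n} → TripleSystem n → Subset n → Set
InShadow {n} H f = ∣ f ∣ ≡ 2 × ∃ λ e → edge H e ≡ true × f ⊆ e

pair : ∀ {n} → Fin n → Fin n → Subset n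
pair x y = ⁅ x ⁆ ∪ ⁅ y ⁆

-- F contains a complete bipartite graph K_{t,t} (parts given by injective
-- maps a, b with disjoint images) with out-codegree at least m in H: every
-- edge {a i, b j} extends to an edge of H by m distinct vertices outside V(K).
HasKttOutCodeg : ∀ {n} → TripleSystem n → Graph n → (t m : ℕ) → Set
HasKttOutCodeg {n} H F t m =
  Σ (Fin t → Fin n) λ a → Σ (Fin t → Fin n) λ b →
    Injective _≡_ _≡_ a × Injective _≡_ _≡_ b ×
    (∀ i j → a i ≢ b j) ×
    (∀ i j → isEdge F (pair (a i) (b j)) ≡ true) ×
    (∀ i j → Σ (Fin m → Fin n) λ v →
        Injective _≡_ _≡_ v ×
        (∀ k → (∀ i' → v k ≢ a i') × (∀ j' → v k ≢ b j')) ×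
        (∀ k → edge H (pair (a i) (b j) ∪ ⁅ v k ⁆) ≡ true))

-- Call a pair xy of F robust if it has at least m + 2t extensions xyz ∈ H, and
-- fragile otherwise; one of the two classes carries half of the density. A greedy
-- Kővári–Sós–Turán argument finds a K_{t,t} in that class: left vertices are added one at
-- a time so that their common neighbourhood among the vertices of large degree shrinks by a
-- factor at most 4q/p per step, and the right vertices are then taken in that neighbourhood.
-- In the robust class the 2t vertices of K block at most 2t extensions of each edge. In the
-- fragile class K is moreover chosen free of "conflicts" (edges of H through an edge of K
-- and a third vertex of K); fragility makes conflicts sparse, so avoiding them costs only a
-- constant factor, and then every extension of an edge of K leaves V(K), so the
-- out-codegree is the full codegree, which is at least m.

module Submission where

open import Defs
open import Data.Bool using (Bool; true; false; _∧_; _∨_; not)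
open import Data.Bool.Properties using (T?; not-injective; ∧-conicalˡ; ∧-conicalʳ)
import Data.Bool.Properties as Bool
open import Data.Nat using (ℕ; zero; suc; NonZero; >-nonZero; s≤s⁻¹; _+_; _*_; _^_; _≤_; _<_; _≤ᵇ_; z≤n; s≤s; _≤?_; _<?_)
open import Data.Nat.Properties hiding (_≟_)
import Data.Nat.ListAction as List
open import Data.Nat.ListAction.Properties using (sum-++)
open import Data.Nat.Solver using (module +-*-Solver)
open import Data.Fin using (Fin; zero; suc; _≟_)
import Data.Fin.Properties as Finₚ
open import Data.Fin.Subset using (Subset; inside; outside; ⊥; ⁅_⁆; _∪_; _⊆_; ∣_∣)
open import Data.Fin.Subset.Properties
  using (_⊆?_; drop-∷-⊆; p⊆q⇒∣p∣≤∣q∣; ∪-identityˡ; ∪-identityʳ; ∪-idem; ∣⁅x⁆∣≡1; ∪-idempotentCommutativeMonoid)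
open import Data.List using ([]; _∷_; _++_; map; filter; length)
open import Data.List.Properties using (map-++; map-∘)
open import Data.Vec using ([]; _∷_; here)
open import Data.Vec.Properties using (≡-dec)
import Data.Vec.Functional as Vector
open import Data.Product using (Σ; ∃; _×_; _,_; proj₁; proj₂)
open import Data.Sum using (_⊎_; inj₁; inj₂)
open import Function using (_∘_)
open import Function.Definitions using (Injective)
open import Relation.Binary.Definitions using (DecidableEquality)
open import Relation.Binary.PropositionalEquality
open import Relation.Nullary using (yes; no; does; contradiction; ofʸ; ofⁿ)
open import Relation.Nullary.Decidable using (dec-true)
open import Algebra.Properties.Semiring.Sum +-*-semiring
  using (sum; sum-syntax; sum-cong-≗; sum-replicate-zero; ∑-distrib-+; ∑-comm; *-distribˡ-sum; *-distribʳ-sum)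
import Algebra.Solver.IdempotentCommutativeMonoid as ICM

open +-*-Solver using (solve; _:+_; _:*_; _:=_; con)

∑-mono-≤ : ∀ {n} {f g : Fin n → ℕ} → (∀ i → f i ≤ g i) → ∑[ i < n ] f i ≤ ∑[ i < n ] g i
∑-mono-≤ {zero} f≤g = z≤n
∑-mono-≤ {suc n} f≤g = +-mono-≤ (f≤g zero) (∑-mono-≤ (f≤g ∘ suc))

∑-distrib-+₃ : ∀ {n} (f g h : Fin n → ℕ) →
  ∑[ i < n ] (f i + (g i + h i)) ≡ ∑[ i < n ] f i + (∑[ i < n ] g i + ∑[ i < n ] h i)
∑-distrib-+₃ f g h = trans (∑-distrib-+ f (λ i → g i + h i)) (cong (sum f +_) (∑-distrib-+ g h))

∑-const : ∀ n c → ∑[ i < n ] c ≡ n * c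
∑-const zero c = refl
∑-const (suc n) c = cong (c +_) (∑-const n c)

∑-≤-const : ∀ {n} c {f : Fin n → ℕ} → (∀ i → f i ≤ c) → ∑[ i < n ] f i ≤ n * c
∑-≤-const {n} c f≤c = ≤-trans (∑-mono-≤ f≤c) (≤-reflexive (∑-const n c))

term-≤-∑ : ∀ {n} (f : Fin n → ℕ) i → f i ≤ ∑[ j < n ] f j
term-≤-∑ f zero = m≤m+n _ _
term-≤-∑ f (suc i) = ≤-trans (term-≤-∑ (f ∘ suc) i) (m≤n+m _ _)

∑≡0⇒≡0 : ∀ {n} (f : Fin n → ℕ) → ∑[ i < n ] f i ≡ 0 → ∀ i → f i ≡ 0
∑≡0⇒≡0 f ∑≡0 zero = m+n≡0⇒m≡0 (f zero) ∑≡0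
∑≡0⇒≡0 f ∑≡0 (suc i) = ∑≡0⇒≡0 (f ∘ suc) (m+n≡0⇒n≡0 (f zero) ∑≡0) i

∑-pigeonhole : ∀ {n} .{{_ : NonZero n}} (f : Fin n → ℕ) → ∃ λ i → ∑[ j < n ] f j ≤ n * f i
∑-pigeonhole {1} f = zero , ≤-refl
∑-pigeonhole {suc (suc n)} f with ∑-pigeonhole (f ∘ suc)
... | i , ∑≤ with f zero ≤? f (suc i)
...   | yes f₀≤fᵢ = suc i , +-mono-≤ f₀≤fᵢ ∑≤
...   | no f₀≰fᵢ = zero , +-monoʳ-≤ (f zero) (≤-trans ∑≤ (*-monoʳ-≤ (suc n) (≰⇒≥ f₀≰fᵢ)))

∑<∑⇒∃< : ∀ {n} (f g : Fin n → ℕ) → ∑[ i < n ] f i < ∑[ i < n ] g i → ∃ λ i → f i < g i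
∑<∑⇒∃< {suc n} f g ∑f<∑g with f zero <? g zero
... | yes f₀<g₀ = zero , f₀<g₀
... | no f₀≮g₀ with ∑<∑⇒∃< (f ∘ suc) (g ∘ suc) (+-cancelˡ-< (f zero) _ _ (≤-trans ∑f<∑g (+-monoˡ-≤ _ (≮⇒≥ f₀≮g₀))))
...   | i , fᵢ<gᵢ = suc i , fᵢ<gᵢ

𝟙 : Bool → ℕ
𝟙 true = 1
𝟙 false = 0

count : ∀ {n} → (Fin n → Bool) → ℕ
count {n} P = ∑[ i < n ] 𝟙 (P i)

𝟙≤1 : ∀ b → 𝟙 b ≤ 1
𝟙≤1 true = ≤-refl
𝟙≤1 false = z≤n

count≤n : ∀ {n} (P : Fin n → Bool) → count P ≤ n
count≤n {n} P = ≤-trans (∑-≤-const 1 (𝟙≤1 ∘ P)) (≤-reflexive (*-identityʳ n))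

𝟙-∧≤𝟙 : ∀ a b → 𝟙 (a ∧ b) ≤ 𝟙 a
𝟙-∧≤𝟙 true b = 𝟙≤1 b
𝟙-∧≤𝟙 false b = z≤n

𝟙≡0⇒≡false : ∀ {b} → 𝟙 b ≡ 0 → b ≡ false
𝟙≡0⇒≡false {false} _ = refl

<𝟙⇒≡true : ∀ {m b} → m < 𝟙 b → b ≡ true × m ≡ 0
<𝟙⇒≡true {zero} {true} _ = refl , refl
<𝟙⇒≡true {suc m} {true} (s≤s ())

∑<count⇒∃ : ∀ {n} (N : Fin n → Bool) (β : Fin n → ℕ) →
  ∑[ u < n ] β u < count N → ∃ λ u → N u ≡ true × β u ≡ 0
∑<count⇒∃ N β lt with ∑<∑⇒∃< β (𝟙 ∘ N) lt
... | u , βᵤ<𝟙 = u , <𝟙⇒≡true βᵤ<𝟙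

count-false : ∀ n → count {n} (λ _ → false) ≡ 0
count-false n = sum-replicate-zero n

count-∧ˡ : ∀ {n} b (P : Fin n → Bool) → count (λ u → b ∧ P u) ≡ 𝟙 b * count P
count-∧ˡ {n} true P = sym (+-identityʳ (count P))
count-∧ˡ {n} false P = sum-replicate-zero n

0<𝟙*⇒≡true : ∀ {b} m → 0 < 𝟙 b * m → b ≡ true
0<𝟙*⇒≡true {true} m _ = refl

any : ∀ {k} → (Fin k → Bool) → Bool
any {zero} f = false
any {suc k} f = f zero ∨ any (f ∘ suc)

any≡false⇒ : ∀ {k} (f : Fin k → Bool) → any f ≡ false → ∀ i → f i ≡ false
any≡false⇒ f eq zero with f zero
... | false = refl
any≡false⇒ f eq (suc i) with f zero
... | false = any≡false⇒ (f ∘ suc) eq i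

any≡true⇒ : ∀ {k} (f : Fin k → Bool) → any f ≡ true → ∃ λ i → f i ≡ true
any≡true⇒ {suc k} f eq with f zero in f₀
... | true = zero , f₀
... | false with any≡true⇒ (f ∘ suc) eq
...   | i , fᵢ = suc i , fᵢ

𝟙-any≤∑ : ∀ {k} (f : Fin k → Bool) → 𝟙 (any f) ≤ ∑[ i < k ] 𝟙 (f i)
𝟙-any≤∑ {zero} f = z≤n
𝟙-any≤∑ {suc k} f with f zero
... | true = s≤s z≤n
... | false = 𝟙-any≤∑ (f ∘ suc)

inImage : ∀ {k n} → (Fin k → Fin n) → Fin n → Bool
inImage a v = any (λ i → does (v ≟ a i))

inImage≡false⇒ : ∀ {k n} (a : Fin k → Fin n) {v} → inImage a v ≡ false → ∀ i → v ≢ a i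
inImage≡false⇒ a {v} eq i with v ≟ a i | any≡false⇒ (λ i → does (v ≟ a i)) eq i
... | no v≢aᵢ | _ = v≢aᵢ

inImage≡true⇒ : ∀ {k n} (a : Fin k → Fin n) {v} → inImage a v ≡ true → ∃ λ i → v ≡ a i
inImage≡true⇒ a {v} eq with any≡true⇒ (λ i → does (v ≟ a i)) eq
... | i , v≟aᵢ with v ≟ a i | v≟aᵢ
...   | yes v≡aᵢ | _ = i , v≡aᵢ

inImage≡false-if : ∀ {k n} (a : Fin k → Fin n) (P : Fin n → Bool) →
  (∀ i → P (a i) ≡ false) → ∀ {v} → P v ≡ true → inImage a v ≡ false
inImage≡false-if a P Pa≡false {v} Pv≡true with inImage a v in v∈a
... | false = refl
... | true with inImage≡true⇒ a {v} v∈a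
...   | i , refl = contradiction (trans (sym Pv≡true) (Pa≡false i)) (λ ())

count-≟ : ∀ {n} (c : Fin n) → count (λ v → does (v ≟ c)) ≡ 1
count-≟ {suc n} zero = cong suc (sum-replicate-zero n)
count-≟ {suc n} (suc c) = count-≟ c

count-inImage≤ : ∀ {k n} (a : Fin k → Fin n) → count (inImage a) ≤ k
count-inImage≤ {k} {n} a = begin
  count (inImage a)                          ≤⟨ ∑-mono-≤ (λ v → 𝟙-any≤∑ (λ i → does (v ≟ a i))) ⟩
  ∑[ v < n ] ∑[ i < k ] 𝟙 (does (v ≟ a i))   ≡⟨ ∑-comm (λ v i → 𝟙 (does (v ≟ a i))) ⟩
  ∑[ i < k ] ∑[ v < n ] 𝟙 (does (v ≟ a i))   ≡⟨ sum-cong-≗ (count-≟ ∘ a) ⟩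
  ∑[ i < k ] 1                               ≡⟨ ∑-const k 1 ⟩
  k * 1                                      ≡⟨ *-identityʳ k ⟩
  k                                          ∎
  where open ≤-Reasoning

∷-injective : ∀ {k n} {v : Fin n} {a : Fin k → Fin n} →
  (∀ i → v ≢ a i) → Injective _≡_ _≡_ a → Injective _≡_ _≡_ (v Vector.∷ a)
∷-injective v∉a a-inj {zero} {zero} _ = refl
∷-injective v∉a a-inj {zero} {suc j} eq = contradiction eq (v∉a j)
∷-injective v∉a a-inj {suc i} {zero} eq = contradiction (sym eq) (v∉a i)
∷-injective v∉a a-inj {suc i} {suc j} eq = cong suc (a-inj eq)

≤count⇒injection : ∀ {n} m (P : Fin n → Bool) → m ≤ count P →
  ∃ λ (v : Fin m → Fin n) → Injective _≡_ _≡_ v × (∀ k → P (v k) ≡ true)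
≤count⇒injection zero P _ = (λ ()) , (λ { {()} }) , (λ ())
≤count⇒injection {suc n} (suc m) P m<count with P zero in P₀
... | true with ≤count⇒injection m (P ∘ suc) (s≤s⁻¹ m<count)
...   | v , v-inj , Pv = zero Vector.∷ (suc ∘ v) , ∷-injective (λ _ ()) (v-inj ∘ Finₚ.suc-injective) , Pv′
  where
  Pv′ : ∀ k → P ((zero Vector.∷ (suc ∘ v)) k) ≡ true
  Pv′ zero = P₀
  Pv′ (suc k) = Pv k
≤count⇒injection {suc n} (suc m) P m<count | false with ≤count⇒injection (suc m) (P ∘ suc) m<count
...   | v , v-inj , Pv = suc ∘ v , v-inj ∘ Finₚ.suc-injective , Pv

∑ˢ : ∀ N → (Subset N → ℕ) → ℕ
∑ˢ N w = List.sum (map w (allSubsets N))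

length-filter : ∀ {A : Set} (P : A → Bool) xs → length (filter (T? ∘ P) xs) ≡ List.sum (map (𝟙 ∘ P) xs)
length-filter P [] = refl
length-filter P (x ∷ xs) with P x
... | true = cong suc (length-filter P xs)
... | false = length-filter P xs

∑ˢ-suc : ∀ N (w : Subset (suc N) → ℕ) → ∑ˢ (suc N) w ≡ ∑ˢ N (w ∘ (outside ∷_)) + ∑ˢ N (w ∘ (inside ∷_))
∑ˢ-suc N w = begin
  List.sum (map w (map (outside ∷_) S ++ map (inside ∷_) S))
    ≡⟨ cong List.sum (map-++ w (map (outside ∷_) S) _) ⟩
  List.sum (map w (map (outside ∷_) S) ++ map w (map (inside ∷_) S))
    ≡⟨ sum-++ (map w (map (outside ∷_) S)) _ ⟩
  List.sum (map w (map (outside ∷_) S)) + List.sum (map w (map (inside ∷_) S))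
    ≡⟨ cong₂ (λ a b → List.sum a + List.sum b) (sym (map-∘ S)) (sym (map-∘ S)) ⟩
  ∑ˢ N (w ∘ (outside ∷_)) + ∑ˢ N (w ∘ (inside ∷_)) ∎
  where
  open ≡-Reasoning
  S = allSubsets N

∑ˢ-mono-≤ : ∀ N {f g : Subset N → ℕ} → (∀ s → f s ≤ g s) → ∑ˢ N f ≤ ∑ˢ N g
∑ˢ-mono-≤ zero f≤g = +-monoˡ-≤ 0 (f≤g [])
∑ˢ-mono-≤ (suc N) {f} {g} f≤g = begin
  ∑ˢ (suc N) f                                     ≡⟨ ∑ˢ-suc N f ⟩
  ∑ˢ N (f ∘ (outside ∷_)) + ∑ˢ N (f ∘ (inside ∷_)) ≤⟨ +-mono-≤ (∑ˢ-mono-≤ N (f≤g ∘ _)) (∑ˢ-mono-≤ N (f≤g ∘ _)) ⟩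
  ∑ˢ N (g ∘ (outside ∷_)) + ∑ˢ N (g ∘ (inside ∷_)) ≡⟨ ∑ˢ-suc N g ⟨
  ∑ˢ (suc N) g                                     ∎
  where open ≤-Reasoning

∑ˢ-zero : ∀ N → ∑ˢ N (λ _ → 0) ≡ 0
∑ˢ-zero zero = refl
∑ˢ-zero (suc N) = trans (∑ˢ-suc N _) (cong₂ _+_ (∑ˢ-zero N) (∑ˢ-zero N))

∑ˢ-∑-comm : ∀ N {k} (f : Subset N → Fin k → ℕ) → ∑ˢ N (λ s → ∑[ i < k ] f s i) ≡ ∑[ i < k ] ∑ˢ N (λ s → f s i)
∑ˢ-∑-comm zero {k} f = trans (+-identityʳ _) (sum-cong-≗ {k} (λ i → sym (+-identityʳ (f [] i))))
∑ˢ-∑-comm (suc N) {k} f = begin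
  ∑ˢ (suc N) (λ s → ∑[ i < k ] f s i)
    ≡⟨ ∑ˢ-suc N _ ⟩
  ∑ˢ N (λ s → ∑[ i < k ] f (outside ∷ s) i) + ∑ˢ N (λ s → ∑[ i < k ] f (inside ∷ s) i)
    ≡⟨ cong₂ _+_ (∑ˢ-∑-comm N {k} _) (∑ˢ-∑-comm N {k} _) ⟩
  ∑[ i < k ] ∑ˢ N (λ s → f (outside ∷ s) i) + ∑[ i < k ] ∑ˢ N (λ s → f (inside ∷ s) i)
    ≡⟨ ∑-distrib-+ (λ i → ∑ˢ N (λ s → f (outside ∷ s) i)) _ ⟨
  ∑[ i < k ] (∑ˢ N (λ s → f (outside ∷ s) i) + ∑ˢ N (λ s → f (inside ∷ s) i))
    ≡⟨ sum-cong-≗ {k} (λ i → ∑ˢ-suc N (λ s → f s i)) ⟨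
  ∑[ i < k ] ∑ˢ (suc N) (λ s → f s i) ∎
  where open ≡-Reasoning

_≟ˢ_ : ∀ {N} → DecidableEquality (Subset N)
_≟ˢ_ = ≡-dec Bool._≟_

∑ˢ-select : ∀ N (t : Subset N) (Q : Subset N → Bool) → ∑ˢ N (λ s → 𝟙 (does (s ≟ˢ t) ∧ Q s)) ≡ 𝟙 (Q t)
∑ˢ-select zero [] Q = +-identityʳ _
∑ˢ-select (suc N) (outside ∷ t) Q =
  trans (∑ˢ-suc N _) (trans (cong₂ _+_ (∑ˢ-select N t (Q ∘ (outside ∷_))) (∑ˢ-zero N)) (+-identityʳ _))
∑ˢ-select (suc N) (inside ∷ t) Q =
  trans (∑ˢ-suc N _) (cong₂ _+_ (∑ˢ-zero N) (∑ˢ-select N t (Q ∘ (inside ∷_))))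

𝟙≤∑-hit : ∀ {k} b (c : Fin k → Bool) z → c z ≡ true → 𝟙 b ≤ ∑[ i < k ] 𝟙 (c i ∧ b)
𝟙≤∑-hit b c z cz≡true = ≤-trans (≤-reflexive (cong (λ x → 𝟙 (x ∧ b)) (sym cz≡true))) (term-≤-∑ (λ i → 𝟙 (c i ∧ b)) z)

∑ˢ-≤-image : ∀ N {k} (Q : Subset N → Bool) (w : Fin k → Subset N) →
  (∀ s → Q s ≡ true → ∃ λ z → s ≡ w z) → ∑ˢ N (𝟙 ∘ Q) ≤ ∑[ z < k ] 𝟙 (Q (w z))
∑ˢ-≤-image N {k} Q w image = begin
  ∑ˢ N (𝟙 ∘ Q)                                         ≤⟨ ∑ˢ-mono-≤ N hit ⟩
  ∑ˢ N (λ s → ∑[ z < k ] 𝟙 (does (s ≟ˢ w z) ∧ Q s))   ≡⟨ ∑ˢ-∑-comm N {k} _ ⟩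
  ∑[ z < k ] ∑ˢ N (λ s → 𝟙 (does (s ≟ˢ w z) ∧ Q s))   ≡⟨ sum-cong-≗ {k} (λ z → ∑ˢ-select N (w z) Q) ⟩
  ∑[ z < k ] 𝟙 (Q (w z))                               ∎
  where
  open ≤-Reasoning
  hit : ∀ s → 𝟙 (Q s) ≤ ∑[ z < k ] 𝟙 (does (s ≟ˢ w z) ∧ Q s)
  hit s with Q s in Qs
  ... | false = z≤n
  ... | true with image s Qs
  ...   | z , s≡wz = 𝟙≤∑-hit true (λ z → does (s ≟ˢ w z)) z (dec-true (s ≟ˢ w z) s≡wz)

∑ˢ-≤-image₂ : ∀ N {k} (Q : Subset N → Bool) (w : Fin k → Fin k → Subset N) →
  (∀ s → Q s ≡ true → ∃ λ x → ∃ λ y → s ≡ w x y) → ∑ˢ N (𝟙 ∘ Q) ≤ ∑[ x < k ] ∑[ y < k ] 𝟙 (Q (w x y))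
∑ˢ-≤-image₂ N {k} Q w image = begin
  ∑ˢ N (𝟙 ∘ Q)
    ≤⟨ ∑ˢ-mono-≤ N hit ⟩
  ∑ˢ N (λ s → ∑[ x < k ] ∑[ y < k ] 𝟙 (does (s ≟ˢ w x y) ∧ Q s))
    ≡⟨ trans (∑ˢ-∑-comm N {k} _) (sum-cong-≗ {k} (λ x → ∑ˢ-∑-comm N {k} _)) ⟩
  ∑[ x < k ] ∑[ y < k ] ∑ˢ N (λ s → 𝟙 (does (s ≟ˢ w x y) ∧ Q s))
    ≡⟨ sum-cong-≗ {k} (λ x → sum-cong-≗ {k} (λ y → ∑ˢ-select N (w x y) Q)) ⟩
  ∑[ x < k ] ∑[ y < k ] 𝟙 (Q (w x y))
    ∎
  where
  open ≤-Reasoning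
  hit : ∀ s → 𝟙 (Q s) ≤ ∑[ x < k ] ∑[ y < k ] 𝟙 (does (s ≟ˢ w x y) ∧ Q s)
  hit s with Q s in Qs
  ... | false = z≤n
  ... | true with image s Qs
  ...   | x , y , s≡wxy = ≤-trans (𝟙≤∑-hit true (λ y → does (s ≟ˢ w x y)) y (dec-true (s ≟ˢ w x y) s≡wxy))
                                  (term-≤-∑ (λ x → ∑[ y < k ] 𝟙 (does (s ≟ˢ w x y) ∧ true)) x)

∣p∣≡0⇒p≡⊥ : ∀ {N} (p : Subset N) → ∣ p ∣ ≡ 0 → p ≡ ⊥
∣p∣≡0⇒p≡⊥ [] _ = refl
∣p∣≡0⇒p≡⊥ (outside ∷ p) ∣p∣≡0 = cong (outside ∷_) (∣p∣≡0⇒p≡⊥ p ∣p∣≡0)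

p⊆q∧∣q∣≡∣p∣⇒q≡p : ∀ {N} {p q : Subset N} → p ⊆ q → ∣ q ∣ ≡ ∣ p ∣ → q ≡ p
p⊆q∧∣q∣≡∣p∣⇒q≡p {p = []} {[]} _ _ = refl
p⊆q∧∣q∣≡∣p∣⇒q≡p {p = inside ∷ p} {outside ∷ q} p⊆q _ with p⊆q here
... | ()
p⊆q∧∣q∣≡∣p∣⇒q≡p {p = inside ∷ p} {inside ∷ q} p⊆q eq =
  cong (inside ∷_) (p⊆q∧∣q∣≡∣p∣⇒q≡p (drop-∷-⊆ p⊆q) (suc-injective eq))
p⊆q∧∣q∣≡∣p∣⇒q≡p {p = outside ∷ p} {outside ∷ q} p⊆q eq =
  cong (outside ∷_) (p⊆q∧∣q∣≡∣p∣⇒q≡p (drop-∷-⊆ p⊆q) eq)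
p⊆q∧∣q∣≡∣p∣⇒q≡p {p = outside ∷ p} {inside ∷ q} p⊆q eq =
  contradiction (≤-trans (≤-reflexive eq) (p⊆q⇒∣p∣≤∣q∣ (drop-∷-⊆ p⊆q))) (<-irrefl refl)

p⊆q∧∣q∣≡1+∣p∣⇒q≡p∪⁅x⁆ : ∀ {N} {p q : Subset N} → p ⊆ q → ∣ q ∣ ≡ suc ∣ p ∣ → ∃ λ x → q ≡ p ∪ ⁅ x ⁆
p⊆q∧∣q∣≡1+∣p∣⇒q≡p∪⁅x⁆ {p = inside ∷ p} {outside ∷ q} p⊆q _ with p⊆q here
... | ()
p⊆q∧∣q∣≡1+∣p∣⇒q≡p∪⁅x⁆ {p = inside ∷ p} {inside ∷ q} p⊆q eq
  with p⊆q∧∣q∣≡1+∣p∣⇒q≡p∪⁅x⁆ (drop-∷-⊆ p⊆q) (suc-injective eq)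
... | x , refl = suc x , refl
p⊆q∧∣q∣≡1+∣p∣⇒q≡p∪⁅x⁆ {p = outside ∷ p} {outside ∷ q} p⊆q eq
  with p⊆q∧∣q∣≡1+∣p∣⇒q≡p∪⁅x⁆ (drop-∷-⊆ p⊆q) eq
... | x , refl = suc x , refl
p⊆q∧∣q∣≡1+∣p∣⇒q≡p∪⁅x⁆ {p = outside ∷ p} {inside ∷ q} p⊆q eq =
  zero , cong (inside ∷_) (trans (p⊆q∧∣q∣≡∣p∣⇒q≡p (drop-∷-⊆ p⊆q) (suc-injective eq)) (sym (∪-identityʳ p)))

∣p∣≡1+k⇒p≡q∪⁅x⁆ : ∀ {N} k (p : Subset N) → ∣ p ∣ ≡ suc k → ∃ λ q → ∃ λ x → p ≡ q ∪ ⁅ x ⁆ × ∣ q ∣ ≡ k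
∣p∣≡1+k⇒p≡q∪⁅x⁆ k (inside ∷ p) eq = outside ∷ p , zero , cong (inside ∷_) (sym (∪-identityʳ p)) , suc-injective eq
∣p∣≡1+k⇒p≡q∪⁅x⁆ k (outside ∷ p) eq with ∣p∣≡1+k⇒p≡q∪⁅x⁆ k p eq
... | q , x , refl , ∣q∣≡k = outside ∷ q , suc x , refl , ∣q∣≡k

∣p∣≡2⇒p≡pair : ∀ {N} (p : Subset N) → ∣ p ∣ ≡ 2 → ∃ λ x → ∃ λ y → p ≡ pair x y
∣p∣≡2⇒p≡pair p ∣p∣≡2 with ∣p∣≡1+k⇒p≡q∪⁅x⁆ 1 p ∣p∣≡2
... | q , y , refl , ∣q∣≡1 with ∣p∣≡1+k⇒p≡q∪⁅x⁆ 0 q ∣q∣≡1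
...   | r , x , refl , ∣r∣≡0 rewrite ∣p∣≡0⇒p≡⊥ r ∣r∣≡0 = x , y , cong (_∪ ⁅ y ⁆) (∪-identityˡ ⁅ x ⁆)

∣pair-x-x∣≡1 : ∀ {N} (x : Fin N) → ∣ pair x x ∣ ≡ 1
∣pair-x-x∣≡1 x = trans (cong ∣_∣ (∪-idem ⁅ x ⁆)) (∣⁅x⁆∣≡1 x)

numEdges≤∑-pairs : ∀ {n} (F : Graph n) → numEdges F ≤ ∑[ x < n ] ∑[ y < n ] 𝟙 (isEdge F (pair x y))
numEdges≤∑-pairs {n} F = ≤-trans (≤-reflexive (length-filter (isEdge F) (allSubsets n)))
  (∑ˢ-≤-image₂ n (isEdge F) pair (λ f f∈F → ∣p∣≡2⇒p≡pair f (size-2 F f f∈F)))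

codeg≤∑-extensions : ∀ {n} (H : TripleSystem n) (f : Subset n) → ∣ f ∣ ≡ 2 →
  codeg H f ≤ ∑[ z < n ] 𝟙 (edge H (f ∪ ⁅ z ⁆))
codeg≤∑-extensions {n} H f ∣f∣≡2 = begin
  codeg H f                                      ≡⟨ length-filter Q (allSubsets n) ⟩
  ∑ˢ n (𝟙 ∘ Q)                                   ≤⟨ ∑ˢ-≤-image n Q (λ z → f ∪ ⁅ z ⁆) extension ⟩
  ∑[ z < n ] 𝟙 (Q (f ∪ ⁅ z ⁆))                   ≤⟨ ∑-mono-≤ (λ z → 𝟙-∧≤𝟙 (edge H (f ∪ ⁅ z ⁆)) _) ⟩
  ∑[ z < n ] 𝟙 (edge H (f ∪ ⁅ z ⁆))              ∎
  where
  open ≤-Reasoning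
  Q : Subset n → Bool
  Q e = edge H e ∧ does (f ⊆? e)
  extension : ∀ e → Q e ≡ true → ∃ λ z → e ≡ f ∪ ⁅ z ⁆
  extension e Qe with edge H e in e∈H | f ⊆? e
  ... | true | yes f⊆e = p⊆q∧∣q∣≡1+∣p∣⇒q≡p∪⁅x⁆ f⊆e (trans (size-3 H e e∈H) (cong suc (sym ∣f∣≡2)))

positive-factor : ∀ {a} b c → 0 < a → a ≤ b * c → 0 < c
positive-factor b zero 0<a a≤b*0 = contradiction (≤-trans 0<a (≤-trans a≤b*0 (≤-reflexive (*-zeroʳ b)))) (λ ())
positive-factor b (suc c) _ _ = s≤s z≤n

record Biclique {n} (t : ℕ) (G : Fin n → Fin n → Bool) (C : Fin n → Fin n → Fin n → Bool) : Set where
  field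
    left right : Fin t → Fin n
    left-injective : Injective _≡_ _≡_ left
    right-injective : Injective _≡_ _≡_ right
    complete : ∀ i j → G (left i) (right j) ≡ true
    left-conflict-free : ∀ {i i'} j → i ≢ i' → C (left i) (left i') (right j) ≡ false
    right-conflict-free : ∀ i {j j'} → j ≢ j' → C (left i) (right j) (right j') ≡ false

-- G is an ordered relation (left vertex, right vertex); C x v z says that v conflicts with
-- the pair xz, and each G-pair has at most M conflicting vertices.
module BicliqueSearch
  {n : ℕ} (t M p q : ℕ)
  (G : Fin n → Fin n → Bool) (C : Fin n → Fin n → Fin n → Bool)
  (C-swap₁₂ : ∀ x y z → C x y z ≡ C y x z)
  (C-swap₂₃ : ∀ x y z → C x y z ≡ C x z y)
  (C-sparse : ∀ x z → G x z ≡ true → count (λ v → C x v z) ≤ M)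
  (G-dense : p * (n * n) ≤ q * ∑[ x < n ] count (G x))
  (p>0 : 0 < p) (n>0 : 0 < n)
  (n-large₁ : 4 * q * t * (1 + M) ≤ p * n)
  (n-large₂ : (4 * q) ^ t * (2 * q) * (t + t * (t * M)) < n)
  where

  instance
    p≢0 : NonZero p
    p≢0 = >-nonZero p>0
    n≢0 : NonZero n
    n≢0 = >-nonZero n>0

  indeg : Fin n → ℕ
  indeg u = count (λ v → G v u)

  highDegree : Fin n → Bool
  highDegree u = p * n ≤ᵇ 2 * q * indeg u

  highDegree⇒ : ∀ {u} → highDegree u ≡ true → p * n ≤ 2 * q * indeg u
  highDegree⇒ {u} eq with highDegree u | ≤ᵇ-reflects-≤ (p * n) (2 * q * indeg u)
  ... | true | ofʸ pn≤ = pn≤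

  indeg-≤ : ∀ u → 2 * q * indeg u ≤ 2 * q * n * 𝟙 (highDegree u) + p * n
  indeg-≤ u with highDegree u | ≤ᵇ-reflects-≤ (p * n) (2 * q * indeg u)
  ... | true | _ = ≤-trans (*-monoʳ-≤ (2 * q) (count≤n (λ v → G v u)))
                        (≤-trans (≤-reflexive (sym (*-identityʳ _))) (m≤m+n _ _))
  ... | false | ofⁿ pn≰ = ≤-trans (<⇒≤ (≰⇒> pn≰)) (m≤n+m _ _)

  count-highDegree : p * n ≤ 2 * q * count highDegree
  count-highDegree = *-cancelʳ-≤ (p * n) (2 * q * count highDegree) n (+-cancelʳ-≤ _ _ _ (begin
    p * n * n + p * n * n                        ≡⟨ solve 2 (λ p n → p :* n :* n :+ p :* n :* n := con 2 :* (p :* (n :* n))) refl p n ⟩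
    2 * (p * (n * n))                            ≤⟨ *-monoʳ-≤ 2 G-dense ⟩
    2 * (q * ∑[ x < n ] count (G x))             ≡⟨ cong (λ e → 2 * (q * e)) (∑-comm (λ x y → 𝟙 (G x y))) ⟩
    2 * (q * ∑[ u < n ] indeg u)                 ≡⟨ trans (sym (*-assoc 2 q _)) (*-distribˡ-sum (2 * q) indeg) ⟩
    ∑[ u < n ] (2 * q * indeg u)                 ≤⟨ ∑-mono-≤ indeg-≤ ⟩
    ∑[ u < n ] (2 * q * n * 𝟙 (highDegree u) + p * n)
      ≡⟨ trans (∑-distrib-+ (λ u → 2 * q * n * 𝟙 (highDegree u)) (λ _ → p * n))
                 (cong₂ _+_ (sym (*-distribˡ-sum (2 * q * n) (𝟙 ∘ highDegree))) (∑-const n (p * n))) ⟩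
    2 * q * n * count highDegree + n * (p * n)
      ≡⟨ solve 4 (λ q n c p → con 2 :* q :* n :* c :+ n :* (p :* n) := con 2 :* q :* c :* n :+ p :* n :* n) refl q n (count highDegree) p ⟩
    2 * q * count highDegree * n + p * n * n     ∎))
    where open ≤-Reasoning

  record LeftPart (k : ℕ) : Set where
    field
      left : Fin k → Fin n
      left-injective : Injective _≡_ _≡_ left
      nbhd : Fin n → Bool
      nbhd⇒highDegree : ∀ {u} → nbhd u ≡ true → p * n ≤ 2 * q * indeg u
      nbhd⇒complete : ∀ {u} → nbhd u ≡ true → ∀ i → G (left i) u ≡ true
      nbhd⇒conflict-free : ∀ {u} → nbhd u ≡ true → ∀ {i j} → i ≢ j → C (left i) (left j) u ≡ false
      nbhd-large : p ^ k * (p * n) ≤ (4 * q) ^ k * (2 * q) * count nbhd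

  emptyLeftPart : LeftPart 0
  emptyLeftPart = record
    { left = λ ()
    ; left-injective = λ { {()} }
    ; nbhd = highDegree
    ; nbhd⇒highDegree = highDegree⇒
    ; nbhd⇒complete = λ _ ()
    ; nbhd⇒conflict-free = λ { _ {()} }
    ; nbhd-large = ≤-trans (≤-reflexive (*-identityˡ (p * n)))
                     (≤-trans count-highDegree (≤-reflexive (cong (_* count highDegree) (sym (*-identityˡ (2 * q))))))
    }

  module ExtendLeft {k} (k<t : k < t) (L : LeftPart k) where
    open LeftPart L

    X : ℕ
    X = count nbhd

    candidate : Fin n → Fin n → Bool
    candidate v u = nbhd u ∧ (G v u ∧ not (any λ i → C (left i) v u))

    -- the size of the new neighbourhood if v is added; the factor makes it 0 for reused v
    gain : Fin n → ℕ
    gain v = count (λ u → not (inImage left v) ∧ candidate v u)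

    paths : ℕ
    paths = ∑[ v < n ] count (λ u → nbhd u ∧ G v u)

    paths-≥ : X * (p * n) ≤ 2 * q * paths
    paths-≥ = begin
      X * (p * n)                                     ≡⟨ *-distribʳ-sum (p * n) (𝟙 ∘ nbhd) ⟩
      ∑[ u < n ] (𝟙 (nbhd u) * (p * n))               ≤⟨ ∑-mono-≤ nbhd-pn-≤ ⟩
      ∑[ u < n ] (2 * q * count (λ v → nbhd u ∧ G v u)) ≡⟨ sym (*-distribˡ-sum (2 * q) (λ u → count (λ v → nbhd u ∧ G v u))) ⟩
      2 * q * ∑[ u < n ] count (λ v → nbhd u ∧ G v u) ≡⟨ cong (2 * q *_) (∑-comm (λ u v → 𝟙 (nbhd u ∧ G v u))) ⟩
      2 * q * paths                                   ∎
      where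
      open ≤-Reasoning
      nbhd-pn-≤ : ∀ u → 𝟙 (nbhd u) * (p * n) ≤ 2 * q * count (λ v → nbhd u ∧ G v u)
      nbhd-pn-≤ u with nbhd u in eq
      ... | false = z≤n
      ... | true = ≤-trans (≤-reflexive (+-identityʳ (p * n))) (nbhd⇒highDegree eq)

    𝟙-path-≤ : ∀ v u → 𝟙 (nbhd u ∧ G v u) ≤
      𝟙 (not (inImage left v) ∧ candidate v u) + (𝟙 (inImage left v ∧ nbhd u) + ∑[ i < k ] 𝟙 (nbhd u ∧ C (left i) v u))
    𝟙-path-≤ v u with nbhd u | G v u | inImage left v
    ... | false | _ | _ = z≤n
    ... | true | false | _ = z≤n
    ... | true | true | true = s≤s z≤n
    ... | true | true | false with any (λ i → C (left i) v u) | 𝟙-any≤∑ (λ i → C (left i) v u)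
    ...   | true | any≤∑ = any≤∑
    ...   | false | _ = s≤s z≤n

    reused-≤ : ∑[ v < n ] count (λ u → inImage left v ∧ nbhd u) ≤ k * X
    reused-≤ = begin
      ∑[ v < n ] count (λ u → inImage left v ∧ nbhd u) ≡⟨ sum-cong-≗ (λ v → count-∧ˡ (inImage left v) nbhd) ⟩
      ∑[ v < n ] (𝟙 (inImage left v) * X)              ≡⟨ sym (*-distribʳ-sum X (𝟙 ∘ inImage left)) ⟩
      count (inImage left) * X                        ≤⟨ *-monoˡ-≤ X (count-inImage≤ left) ⟩
      k * X                                           ∎
      where open ≤-Reasoning

    conflicting-≤ : ∑[ v < n ] ∑[ u < n ] ∑[ i < k ] 𝟙 (nbhd u ∧ C (left i) v u) ≤ X * (k * M)
    conflicting-≤ = begin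
      ∑[ v < n ] ∑[ u < n ] ∑[ i < k ] 𝟙 (nbhd u ∧ C (left i) v u)
        ≡⟨ ∑-comm (λ v u → ∑[ i < k ] 𝟙 (nbhd u ∧ C (left i) v u)) ⟩
      ∑[ u < n ] ∑[ v < n ] ∑[ i < k ] 𝟙 (nbhd u ∧ C (left i) v u)
        ≡⟨ sum-cong-≗ (λ u → ∑-comm (λ v i → 𝟙 (nbhd u ∧ C (left i) v u))) ⟩
      ∑[ u < n ] ∑[ i < k ] count (λ v → nbhd u ∧ C (left i) v u)
        ≤⟨ ∑-mono-≤ conflicting-at-≤ ⟩
      ∑[ u < n ] (𝟙 (nbhd u) * (k * M))               ≡⟨ sym (*-distribʳ-sum (k * M) (𝟙 ∘ nbhd)) ⟩
      X * (k * M)                                     ∎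
      where
      open ≤-Reasoning
      conflicting-at-≤ : ∀ u → ∑[ i < k ] count (λ v → nbhd u ∧ C (left i) v u) ≤ 𝟙 (nbhd u) * (k * M)
      conflicting-at-≤ u with nbhd u in eq
      ... | false = ≤-reflexive (trans (sum-cong-≗ {k} (λ _ → count-false n)) (sum-replicate-zero k))
      ... | true = ≤-trans (∑-≤-const M (λ i → C-sparse (left i) u (nbhd⇒complete eq i)))
                           (≤-reflexive (sym (+-identityʳ (k * M))))

    paths-≤ : paths ≤ ∑[ v < n ] gain v + (k * X + X * (k * M))
    paths-≤ = begin
      paths
        ≤⟨ ∑-mono-≤ (λ v → ∑-mono-≤ (𝟙-path-≤ v)) ⟩
      ∑[ v < n ] ∑[ u < n ] (𝟙 (not (inImage left v) ∧ candidate v u) +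
        (𝟙 (inImage left v ∧ nbhd u) + ∑[ i < k ] 𝟙 (nbhd u ∧ C (left i) v u)))
        ≡⟨ trans (sum-cong-≗ {n} (λ v → ∑-distrib-+₃ {n} _ _ _)) (∑-distrib-+₃ {n} _ _ _) ⟩
      ∑[ v < n ] gain v + (∑[ v < n ] count (λ u → inImage left v ∧ nbhd u) +
        ∑[ v < n ] ∑[ u < n ] ∑[ i < k ] 𝟙 (nbhd u ∧ C (left i) v u))
        ≤⟨ +-monoʳ-≤ (∑[ v < n ] gain v) (+-mono-≤ reused-≤ conflicting-≤) ⟩
      ∑[ v < n ] gain v + (k * X + X * (k * M))
        ∎
      where open ≤-Reasoning

    -- n-large₁ makes the reused and conflicting paths at most half of all paths
    total-gain : X * (p * n) ≤ 4 * q * ∑[ v < n ] gain v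
    total-gain = +-cancelʳ-≤ _ _ _ (begin
      X * (p * n) + X * (p * n)                   ≤⟨ +-mono-≤ paths-≥ paths-≥ ⟩
      2 * q * paths + 2 * q * paths               ≤⟨ +-mono-≤ (*-monoʳ-≤ (2 * q) paths-≤) (*-monoʳ-≤ (2 * q) paths-≤) ⟩
      2 * q * (Γ + (k * X + X * (k * M))) + 2 * q * (Γ + (k * X + X * (k * M)))
        ≡⟨ solve 5 (λ q Γ k X M → con 2 :* q :* (Γ :+ (k :* X :+ X :* (k :* M))) :+ con 2 :* q :* (Γ :+ (k :* X :+ X :* (k :* M)))
                                := con 4 :* q :* Γ :+ X :* (con 4 :* q :* k :* (con 1 :+ M))) refl q Γ k X M ⟩
      4 * q * Γ + X * (4 * q * k * (1 + M))       ≤⟨ +-monoʳ-≤ (4 * q * Γ) (*-monoʳ-≤ X k-small) ⟩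
      4 * q * Γ + X * (p * n)                     ∎)
      where
      open ≤-Reasoning
      Γ = ∑[ v < n ] gain v
      k-small : 4 * q * k * (1 + M) ≤ p * n
      k-small = ≤-trans (*-monoˡ-≤ (1 + M) (*-monoʳ-≤ (4 * q) (<⇒≤ k<t))) n-large₁

    best : ∃ λ v → ∑[ w < n ] gain w ≤ n * gain v
    best = ∑-pigeonhole gain

    v : Fin n
    v = proj₁ best

    gain-v-≥ : X * p ≤ 4 * q * gain v
    gain-v-≥ = *-cancelʳ-≤ (X * p) (4 * q * gain v) n (begin
      X * p * n                  ≡⟨ *-assoc X p n ⟩
      X * (p * n)                ≤⟨ total-gain ⟩
      4 * q * ∑[ w < n ] gain w  ≤⟨ *-monoʳ-≤ (4 * q) (proj₂ best) ⟩
      4 * q * (n * gain v)       ≡⟨ solve 3 (λ q n g → con 4 :* q :* (n :* g) := con 4 :* q :* g :* n) refl q n (gain v) ⟩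
      4 * q * gain v * n         ∎)
      where open ≤-Reasoning

    gain-v>0 : 0 < gain v
    gain-v>0 = positive-factor (4 * q) (gain v) (*-mono-< X>0 p>0) gain-v-≥
      where
      X>0 : 0 < X
      X>0 = positive-factor ((4 * q) ^ k * (2 * q)) X (*-mono-< (m^n>0 p k) (*-mono-< p>0 n>0)) nbhd-large

    v∉left : inImage left v ≡ false
    v∉left = not-injective (0<𝟙*⇒≡true (count (candidate v))
               (subst (0 <_) (count-∧ˡ (not (inImage left v)) (candidate v)) gain-v>0))

    gain-v≡ : gain v ≡ count (candidate v)
    gain-v≡ = trans (count-∧ˡ (not (inImage left v)) (candidate v))
                    (trans (cong (λ b → 𝟙 (not b) * count (candidate v)) v∉left) (+-identityʳ _))

    module _ {u} (cand : candidate v u ≡ true) where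
      candidate⇒nbhd : nbhd u ≡ true
      candidate⇒nbhd = ∧-conicalˡ _ _ cand

      candidate⇒adjacent : G v u ≡ true
      candidate⇒adjacent = ∧-conicalˡ _ _ (∧-conicalʳ (nbhd u) _ cand)

      candidate⇒conflict-free : ∀ i → C (left i) v u ≡ false
      candidate⇒conflict-free = any≡false⇒ (λ i → C (left i) v u)
                                  (not-injective (∧-conicalʳ _ _ (∧-conicalʳ (nbhd u) _ cand)))

    extended : LeftPart (suc k)
    extended = record
      { left = v Vector.∷ left
      ; left-injective = ∷-injective (inImage≡false⇒ left v∉left) left-injective
      ; nbhd = candidate v
      ; nbhd⇒highDegree = nbhd⇒highDegree ∘ candidate⇒nbhd
      ; nbhd⇒complete = complete′
      ; nbhd⇒conflict-free = conflict-free′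
      ; nbhd-large = large′
      }
      where
      complete′ : ∀ {u} → candidate v u ≡ true → ∀ i → G ((v Vector.∷ left) i) u ≡ true
      complete′ cand zero = candidate⇒adjacent cand
      complete′ cand (suc i) = nbhd⇒complete (candidate⇒nbhd cand) i

      conflict-free′ : ∀ {u} → candidate v u ≡ true → ∀ {i j} → i ≢ j →
        C ((v Vector.∷ left) i) ((v Vector.∷ left) j) u ≡ false
      conflict-free′ cand {zero} {zero} 0≢0 = contradiction refl 0≢0
      conflict-free′ {u} cand {zero} {suc j} _ = trans (C-swap₁₂ v (left j) u) (candidate⇒conflict-free cand j)
      conflict-free′ cand {suc i} {zero} _ = candidate⇒conflict-free cand i
      conflict-free′ cand {suc i} {suc j} i≢j = nbhd⇒conflict-free (candidate⇒nbhd cand) (i≢j ∘ cong suc)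

      large′ : p ^ suc k * (p * n) ≤ (4 * q) ^ suc k * (2 * q) * count (candidate v)
      large′ = begin
        p ^ suc k * (p * n)                  ≡⟨ *-assoc p (p ^ k) (p * n) ⟩
        p * (p ^ k * (p * n))                ≤⟨ *-monoʳ-≤ p nbhd-large ⟩
        p * ((4 * q) ^ k * (2 * q) * X)      ≡⟨ solve 3 (λ p B X → p :* (B :* X) := B :* (X :* p)) refl p ((4 * q) ^ k * (2 * q)) X ⟩
        (4 * q) ^ k * (2 * q) * (X * p)      ≤⟨ *-monoʳ-≤ ((4 * q) ^ k * (2 * q)) gain-v-≥ ⟩
        (4 * q) ^ k * (2 * q) * (4 * q * gain v)
          ≡⟨ solve 4 (λ w q g d → w :* d :* (con 4 :* q :* g) := con 4 :* q :* w :* d :* g) refl ((4 * q) ^ k) q (gain v) (2 * q) ⟩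
        (4 * q) ^ suc k * (2 * q) * gain v   ≡⟨ cong ((4 * q) ^ suc k * (2 * q) *_) gain-v≡ ⟩
        (4 * q) ^ suc k * (2 * q) * count (candidate v) ∎
        where open ≤-Reasoning

  leftPart : ∀ k → k ≤ t → LeftPart k
  leftPart zero _ = emptyLeftPart
  leftPart (suc k) k<t = ExtendLeft.extended k<t (leftPart k (<⇒≤ k<t))

  open LeftPart (leftPart t ≤-refl)

  final-nbhd-large : t + t * (t * M) < count nbhd
  final-nbhd-large = *-cancelˡ-< B _ _ (begin-strict
    B * (t + t * (t * M))   <⟨ n-large₂ ⟩
    n                       ≤⟨ m≤n*m n p ⟩
    p * n                   ≤⟨ m≤n*m (p * n) (p ^ t) {{m^n≢0 p t}} ⟩
    p ^ t * (p * n)         ≤⟨ nbhd-large ⟩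
    B * count nbhd          ∎)
    where
    open ≤-Reasoning
    B = (4 * q) ^ t * (2 * q)

  record RightPart (l : ℕ) : Set where
    field
      right : Fin l → Fin n
      right-injective : Injective _≡_ _≡_ right
      right⊆nbhd : ∀ j → nbhd (right j) ≡ true
      right-conflict-free : ∀ i {j j'} → j ≢ j' → C (left i) (right j) (right j') ≡ false

  emptyRightPart : RightPart 0
  emptyRightPart = record
    { right = λ ()
    ; right-injective = λ { {()} }
    ; right⊆nbhd = λ ()
    ; right-conflict-free = λ { _ {()} }
    }

  module ExtendRight {l} (l<t : l < t) (R : RightPart l) where
    open RightPart R

    badness : Fin n → ℕ
    badness u = 𝟙 (inImage right u) + ∑[ i < t ] ∑[ j < l ] 𝟙 (C (left i) (right j) u)

    conflicts-≤ : ∀ i j → count (λ u → C (left i) (right j) u) ≤ M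
    conflicts-≤ i j = ≤-trans (≤-reflexive (sum-cong-≗ (λ u → cong 𝟙 (C-swap₂₃ (left i) (right j) u))))
                              (C-sparse (left i) (right j) (nbhd⇒complete (right⊆nbhd j) i))

    total-badness : ∑[ u < n ] badness u ≤ t + t * (t * M)
    total-badness = begin
      ∑[ u < n ] badness u
        ≡⟨ ∑-distrib-+ (𝟙 ∘ inImage right) _ ⟩
      count (inImage right) + ∑[ u < n ] ∑[ i < t ] ∑[ j < l ] 𝟙 (C (left i) (right j) u)
        ≡⟨ cong (count (inImage right) +_) (trans (∑-comm {n} {t} _) (sum-cong-≗ {t} (λ i → ∑-comm {n} {l} _))) ⟩
      count (inImage right) + ∑[ i < t ] ∑[ j < l ] count (λ u → C (left i) (right j) u)
        ≤⟨ +-mono-≤ (count-inImage≤ right) (∑-≤-const (l * M) (λ i → ∑-≤-const M (conflicts-≤ i))) ⟩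
      l + t * (l * M)
        ≤⟨ +-mono-≤ (<⇒≤ l<t) (*-monoʳ-≤ t (*-monoˡ-≤ M (<⇒≤ l<t))) ⟩
      t + t * (t * M)
        ∎
      where open ≤-Reasoning

    good : ∃ λ u → nbhd u ≡ true × badness u ≡ 0
    good = ∑<count⇒∃ nbhd badness (≤-trans (s≤s total-badness) final-nbhd-large)

    u : Fin n
    u = proj₁ good

    u∉right : ∀ j → u ≢ right j
    u∉right = inImage≡false⇒ right (𝟙≡0⇒≡false (m+n≡0⇒m≡0 _ (proj₂ (proj₂ good))))

    u-conflict-free : ∀ i j → C (left i) (right j) u ≡ false
    u-conflict-free i j = 𝟙≡0⇒≡false (∑≡0⇒≡0 _ (∑≡0⇒≡0 _ (m+n≡0⇒n≡0 (𝟙 (inImage right u)) (proj₂ (proj₂ good))) i) j)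

    extended : RightPart (suc l)
    extended = record
      { right = u Vector.∷ right
      ; right-injective = ∷-injective u∉right right-injective
      ; right⊆nbhd = right⊆nbhd′
      ; right-conflict-free = conflict-free′
      }
      where
      right⊆nbhd′ : ∀ j → nbhd ((u Vector.∷ right) j) ≡ true
      right⊆nbhd′ zero = proj₁ (proj₂ good)
      right⊆nbhd′ (suc j) = right⊆nbhd j

      conflict-free′ : ∀ i {j j'} → j ≢ j' → C (left i) ((u Vector.∷ right) j) ((u Vector.∷ right) j') ≡ false
      conflict-free′ i {zero} {zero} 0≢0 = contradiction refl 0≢0
      conflict-free′ i {zero} {suc j'} _ = trans (C-swap₂₃ (left i) u (right j')) (u-conflict-free i j')
      conflict-free′ i {suc j} {zero} _ = u-conflict-free i j
      conflict-free′ i {suc j} {suc j'} j≢j' = right-conflict-free i (j≢j' ∘ cong suc)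

  rightPart : ∀ l → l ≤ t → RightPart l
  rightPart zero _ = emptyRightPart
  rightPart (suc l) l<t = ExtendRight.extended l<t (rightPart l (<⇒≤ l<t))

  biclique : Biclique t G C
  biclique = record
    { left = left
    ; right = right
    ; left-injective = left-injective
    ; right-injective = right-injective
    ; complete = λ i j → nbhd⇒complete (right⊆nbhd j) i
    ; left-conflict-free = λ j → nbhd⇒conflict-free (right⊆nbhd j)
    ; right-conflict-free = right-conflict-free
    }
    where open RightPart (rightPart t ≤-refl)

avoids : ∀ {t n} → (Fin t → Fin n) → (Fin t → Fin n) → Fin n → Bool
avoids a b z = not (inImage a z) ∧ not (inImage b z)

isEdge-pair⇒≢ : ∀ {n} (F : Graph n) {x y} → isEdge F (pair x y) ≡ true → x ≢ y
isEdge-pair⇒≢ F {x} xy∈F refl = contradiction (trans (sym (size-2 F _ xy∈F)) (∣pair-x-x∣≡1 x)) (λ ())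

outWitnesses : ∀ {n t} m (H : TripleSystem n) (a b : Fin t → Fin n) {x y} →
  m ≤ count (λ z → edge H (pair x y ∪ ⁅ z ⁆) ∧ avoids a b z) →
  Σ (Fin m → Fin n) λ v → Injective _≡_ _≡_ v ×
    (∀ k → (∀ i → v k ≢ a i) × (∀ j → v k ≢ b j)) ×
    (∀ k → edge H (pair x y ∪ ⁅ v k ⁆) ≡ true)
outWitnesses m H a b {x} {y} m≤count with ≤count⇒injection m _ m≤count
... | v , v-inj , Pv = v , v-inj , (λ k → inImage≡false⇒ a (∉a k) , inImage≡false⇒ b (∉b k)) , (λ k → ∧-conicalˡ _ _ (Pv k))
  where
  avoid : ∀ k → avoids a b (v k) ≡ true
  avoid k = ∧-conicalʳ (edge H (pair x y ∪ ⁅ v k ⁆)) _ (Pv k)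
  ∉a : ∀ k → inImage a (v k) ≡ false
  ∉a k = not-injective (∧-conicalˡ _ _ (avoid k))
  ∉b : ∀ k → inImage b (v k) ≡ false
  ∉b k = not-injective (∧-conicalʳ (not (inImage a (v k))) _ (avoid k))

biclique⇒HasKttOutCodeg : ∀ {n t m} (H : TripleSystem n) (F : Graph n) {G C} (K : Biclique t G C) →
  (∀ {x y} → G x y ≡ true → isEdge F (pair x y) ≡ true) →
  (let open Biclique K in
    ∀ i j → m ≤ count (λ z → edge H (pair (left i) (right j) ∪ ⁅ z ⁆) ∧ avoids left right z)) →
  HasKttOutCodeg H F t m
biclique⇒HasKttOutCodeg {m = m} H F K G⊆F enough =
  left , right , left-injective , right-injective ,
  (λ i j → isEdge-pair⇒≢ F (edge-in-F i j)) , edge-in-F ,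
  (λ i j → outWitnesses m H left right (enough i j))
  where
  open Biclique K
  edge-in-F : ∀ i j → isEdge F (pair (left i) (right j)) ≡ true
  edge-in-F i j = G⊆F (complete i j)

𝟙≤𝟙-avoiding : ∀ e a b → 𝟙 e ≤ 𝟙 (e ∧ (not a ∧ not b)) + (𝟙 a + 𝟙 b)
𝟙≤𝟙-avoiding false a b = z≤n
𝟙≤𝟙-avoiding true true b = s≤s z≤n
𝟙≤𝟙-avoiding true false true = s≤s z≤n
𝟙≤𝟙-avoiding true false false = s≤s z≤n

𝟙-split : ∀ a b → 𝟙 a ≡ 𝟙 (a ∧ b) + 𝟙 (a ∧ not b)
𝟙-split true true = refl
𝟙-split true false = refl
𝟙-split false b = refl

edge-pair≡false : ∀ {n} (H : TripleSystem n) {x y} → ∣ pair x y ∣ ≡ 2 → edge H (pair x y) ≡ false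
edge-pair≡false H {x} {y} ∣xy∣≡2 with edge H (pair x y) in xy∈H
... | false = refl
... | true = contradiction (trans (sym (size-3 H _ xy∈H)) ∣xy∣≡2) (λ ())

≤-split-half : ∀ {a q x y} → a ≤ q * (x + y) → a ≤ 2 * q * x ⊎ a ≤ 2 * q * y
≤-split-half {a} {q} {x} {y} a≤ with a ≤? 2 * q * x
... | yes a≤2qx = inj₁ a≤2qx
... | no a≰2qx = inj₂ (+-cancelˡ-≤ a a (2 * q * y) (begin
  a + a                     ≡⟨ solve 1 (λ a → a :+ a := con 2 :* a) refl a ⟩
  2 * a                     ≤⟨ *-monoʳ-≤ 2 a≤ ⟩
  2 * (q * (x + y))         ≡⟨ solve 3 (λ q x y → con 2 :* (q :* (x :+ y)) := con 2 :* q :* x :+ con 2 :* q :* y) refl q x y ⟩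
  2 * q * x + 2 * q * y     ≤⟨ +-monoˡ-≤ (2 * q * y) (<⇒≤ (≰⇒> a≰2qx)) ⟩
  a + 2 * q * y             ∎))
  where open ≤-Reasoning

module RobustFragile (m t : ℕ) {n} (H : TripleSystem n) (F : Graph n) where

  open ICM (∪-idempotentCommutativeMonoid n) using (_⊕_; _⊜_) renaming (solve to ∪-solve)

  M : ℕ
  M = m + (t + t)

  extensions : Fin n → Fin n → ℕ
  extensions x y = count (λ z → edge H (pair x y ∪ ⁅ z ⁆))

  robust : Fin n → Fin n → Bool
  robust x y = M ≤ᵇ extensions x y

  Gʳ Gᶠ : Fin n → Fin n → Bool
  Gʳ x y = isEdge F (pair x y) ∧ robust x y
  Gᶠ x y = isEdge F (pair x y) ∧ not (robust x y)

  Cᶠ : Fin n → Fin n → Fin n → Bool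
  Cᶠ x y z = edge H (pair x z ∪ ⁅ y ⁆)

  Cᶠ-swap₁₂ : ∀ x y z → Cᶠ x y z ≡ Cᶠ y x z
  Cᶠ-swap₁₂ x y z = cong (edge H) (∪-solve 3 (λ x y z → (x ⊕ z) ⊕ y ⊜ (y ⊕ z) ⊕ x) refl ⁅ x ⁆ ⁅ y ⁆ ⁅ z ⁆)

  Cᶠ-swap₂₃ : ∀ x y z → Cᶠ x y z ≡ Cᶠ x z y
  Cᶠ-swap₂₃ x y z = cong (edge H) (∪-solve 3 (λ x y z → (x ⊕ z) ⊕ y ⊜ (x ⊕ y) ⊕ z) refl ⁅ x ⁆ ⁅ y ⁆ ⁅ z ⁆)

  Cᶠ-sparse : ∀ x z → Gᶠ x z ≡ true → count (λ v → Cᶠ x v z) ≤ M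
  Cᶠ-sparse x z xz∈Gᶠ with robust x z | ≤ᵇ-reflects-≤ M (extensions x z) | ∧-conicalʳ (isEdge F (pair x z)) _ xz∈Gᶠ
  ... | false | ofⁿ M≰ | _ = <⇒≤ (≰⇒> M≰)

  edges-split : ∑[ x < n ] ∑[ y < n ] 𝟙 (isEdge F (pair x y)) ≡
    ∑[ x < n ] count (Gʳ x) + ∑[ x < n ] count (Gᶠ x)
  edges-split = trans
    (sum-cong-≗ {n} (λ x → trans (sum-cong-≗ {n} (λ y → 𝟙-split (isEdge F (pair x y)) (robust x y)))
                                  (∑-distrib-+ (λ y → 𝟙 (Gʳ x y)) (λ y → 𝟙 (Gᶠ x y)))))
    (∑-distrib-+ (count ∘ Gʳ) (count ∘ Gᶠ))

  robust⇒ : ∀ {x y} → robust x y ≡ true → M ≤ extensions x y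
  robust⇒ {x} {y} xy-robust with robust x y | ≤ᵇ-reflects-≤ M (extensions x y)
  ... | true | ofʸ M≤ = M≤

  robust-case : Biclique t Gʳ (λ _ _ _ → false) → HasKttOutCodeg H F t m
  robust-case K = biclique⇒HasKttOutCodeg H F K (∧-conicalˡ _ _) enough
    where
    open Biclique K
    enough : ∀ i j → m ≤ count (λ z → edge H (pair (left i) (right j) ∪ ⁅ z ⁆) ∧ avoids left right z)
    enough i j = +-cancelʳ-≤ (t + t) m _ (begin
      M                                                       ≤⟨ robust⇒ (∧-conicalʳ _ _ (complete i j)) ⟩
      extensions (left i) (right j)                           ≤⟨ ∑-mono-≤ (λ z → 𝟙≤𝟙-avoiding (E z) (inImage left z) (inImage right z)) ⟩
      ∑[ z < n ] (𝟙 (E z ∧ avoids left right z) + (𝟙 (inImage left z) + 𝟙 (inImage right z)))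
        ≡⟨ ∑-distrib-+₃ (λ z → 𝟙 (E z ∧ avoids left right z)) _ _ ⟩
      count (λ z → E z ∧ avoids left right z) + (count (inImage left) + count (inImage right))
        ≤⟨ +-monoʳ-≤ (count (λ z → E z ∧ avoids left right z)) (+-mono-≤ (count-inImage≤ left) (count-inImage≤ right)) ⟩
      count (λ z → E z ∧ avoids left right z) + (t + t)       ∎)
      where
      open ≤-Reasoning
      E : Fin n → Bool
      E z = edge H (pair (left i) (right j) ∪ ⁅ z ⁆)

  fragile-case : (∀ f → isEdge F f ≡ true → m ≤ codeg H f) → Biclique t Gᶠ Cᶠ → HasKttOutCodeg H F t m
  fragile-case codeg≥m K = biclique⇒HasKttOutCodeg H F K (∧-conicalˡ _ _) enough
    where
    open Biclique K
    enough : ∀ i j → m ≤ count (λ z → edge H (pair (left i) (right j) ∪ ⁅ z ⁆) ∧ avoids left right z)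
    enough i j = begin
      m                                        ≤⟨ codeg≥m _ xy∈F ⟩
      codeg H (pair x y)                       ≤⟨ codeg≤∑-extensions H _ ∣xy∣≡2 ⟩
      extensions x y                           ≡⟨ sum-cong-≗ {n} (cong 𝟙 ∘ E⇒avoids) ⟩
      count (λ z → E z ∧ avoids left right z)  ∎
      where
      open ≤-Reasoning
      x = left i
      y = right j
      xy∈F = ∧-conicalˡ _ _ (complete i j)
      ∣xy∣≡2 = size-2 F _ xy∈F
      E : Fin n → Bool
      E z = edge H (pair x y ∪ ⁅ z ⁆)

      E-left : ∀ i' → E (left i') ≡ false
      E-left i' with i' ≟ i
      ... | yes refl = trans (cong (edge H) (∪-solve 2 (λ x y → (x ⊕ y) ⊕ x ⊜ x ⊕ y) refl ⁅ x ⁆ ⁅ y ⁆))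
                             (edge-pair≡false H ∣xy∣≡2)
      ... | no i'≢i = left-conflict-free j (i'≢i ∘ sym)

      E-right : ∀ j' → E (right j') ≡ false
      E-right j' with j' ≟ j
      ... | yes refl = trans (cong (edge H) (∪-solve 2 (λ x y → (x ⊕ y) ⊕ y ⊜ x ⊕ y) refl ⁅ x ⁆ ⁅ y ⁆))
                             (edge-pair≡false H ∣xy∣≡2)
      ... | no j'≢j = right-conflict-free i j'≢j

      E⇒avoids : ∀ z → E z ≡ E z ∧ avoids left right z
      E⇒avoids z with E z in Ez
      ... | false = refl
      ... | true rewrite inImage≡false-if left E E-left Ez | inImage≡false-if right E E-right Ez = refl

  dense⇒HasKttOutCodeg : ∀ p q → 0 < p → 0 < n →
    4 * (2 * q) * t * (1 + M) ≤ p * n →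
    (4 * (2 * q)) ^ t * (2 * (2 * q)) * (t + t * (t * M)) < n →
    (∀ f → isEdge F f ≡ true → m ≤ codeg H f) →
    p * (n * n) ≤ q * ∑[ x < n ] ∑[ y < n ] 𝟙 (isEdge F (pair x y)) →
    HasKttOutCodeg H F t m
  dense⇒HasKttOutCodeg p q p>0 n>0 large₁ large₂ codeg≥m dense
    with ≤-split-half {q = q} (subst (λ e → p * (n * n) ≤ q * e) edges-split dense)
  ... | inj₁ robust-dense = robust-case (BicliqueSearch.biclique t M p (2 * q) Gʳ (λ _ _ _ → false)
          (λ _ _ _ → refl) (λ _ _ _ → refl) (λ _ _ _ → ≤-trans (≤-reflexive (count-false n)) z≤n)
          robust-dense p>0 n>0 large₁ large₂)
  ... | inj₂ fragile-dense = fragile-case codeg≥m (BicliqueSearch.biclique t M p (2 * q) Gᶠ Cᶠ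
          Cᶠ-swap₁₂ Cᶠ-swap₂₃ Cᶠ-sparse fragile-dense p>0 n>0 large₁ large₂)

-- The thresholds are those of BicliqueSearch for the
-- density p/2q that the robust/fragile split leaves.
lemma4p18 : (m t p q : ℕ) → 0 < p → 0 < q →
    ∃ λ n₀ → ∀ n → n₀ ≤ n →
      (H : TripleSystem n) (F : Graph n) →
      (∀ f → isEdge F f ≡ true → InShadow H f) →
      (∀ f → isEdge F f ≡ true → m ≤ codeg H f) →
      p * n ^ 2 ≤ q * numEdges F →
      HasKttOutCodeg H F t m
lemma4p18 m t p q p>0 _ = suc (A + B) , λ n n₀≤n H F _ codeg≥m dense →
  RobustFragile.dense⇒HasKttOutCodeg m t H F p q p>0 (≤-trans (s≤s z≤n) n₀≤n)
    (≤-trans (m≤m+n A B) (≤-trans (n≤1+n _) (≤-trans n₀≤n (m≤n*m n p {{>-nonZero p>0}}))))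
    (≤-trans (s≤s (m≤n+m B A)) n₀≤n)
    codeg≥m
    (≤-trans (≤-reflexive (cong (λ k → p * (n * k)) (sym (*-identityʳ n))))
             (≤-trans dense (*-monoʳ-≤ q (numEdges≤∑-pairs F))))
  where
  M = m + (t + t)
  A = 4 * (2 * q) * t * (1 + M)
  B = (4 * (2 * q)) ^ t * (2 * (2 * q)) * (t + t * (t * M))
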